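{- Let $(\mathcal P,\mathcal O)$ be a 3-twined semitopology and $f,f':\mathcal P\to\mathbf 3$. Then $$\mathsf{Quorum} f\wedge\mathsf{Quorum} f'\le\mathsf{Contraquorum}(f\wedge f').$$ As a corollary, if $\mathsf{Quorum} f\wedge\mathsf{Quorum} f'$ is valid then $\mathsf{Contraquorum}(f\wedge f')$ is valid.
   Context: Truth values: $\mathbf 3=\{\mathbf f,\mathbf b,\mathbf t\}$ totally ordered by $\mathbf f<\mathbf b<\mathbf t$; $\wedge$ is min, $\bigwedge,\bigvee$ are infimum and supremum; $(f\wedge f')(p)=f(p)\wedge f'(p)$. A truth value is valid iff it lies in $\{\mathbf t,\mathbf b\}$. A semitopology $(\mathcal P,\mathcal O)$ is a set $\mathcal P$ with a family $\mathcal O$ of subsets containing $\mathcal P$ and closed under arbitrary (including empty) unions; $\mathcal O^{\neq\emptyset}$ is the set of nonempty members. It is 3-twined if any three members of $\mathcal O^{\neq\emptyset}$ have nonempty intersection. For $f:\mathcal P\to\mathbf 3$: $\mathsf{Quorum} f=\bigvee_{O\in\mathcal O^{\neq\emptyset}}\bigwedge_{p\in O}f(p)$ and $\mathsf{Contraquorum} f=\bigwedge_{O\in\mathcal O^{\neq\emptyset}}\bigvee_{p\in O}f(p)$. -}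

module Defs where

open import Data.Product using (Σ; _×_; _,_)
open import Data.Unit using (⊤)
open import Relation.Binary.PropositionalEquality using (_≡_)

data 𝟛 : Set where
  𝐟 𝐛 𝐭 : 𝟛

data _≤₃_ : 𝟛 → 𝟛 → Set where
  f≤ : ∀ {x} → 𝐟 ≤₃ x
  b≤b : 𝐛 ≤₃ 𝐛
  b≤t : 𝐛 ≤₃ 𝐭
  t≤t : 𝐭 ≤₃ 𝐭

_∧₃_ : 𝟛 → 𝟛 → 𝟛
𝐟 ∧₃ y = 𝐟
𝐛 ∧₃ 𝐟 = 𝐟
𝐛 ∧₃ y = 𝐛
𝐭 ∧₃ y = y

_∧ᶠ_ : {P : Set} → (P → 𝟛) → (P → 𝟛) → (P → 𝟛)
(f ∧ᶠ f') p = f p ∧₃ f' p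

data Valid : 𝟛 → Set where
  valid-t : Valid 𝐭
  valid-b : Valid 𝐛

IsLowerBound : (𝟛 → Set) → 𝟛 → Set
IsLowerBound S v = ∀ x → S x → v ≤₃ x

IsUpperBound : (𝟛 → Set) → 𝟛 → Set
IsUpperBound S v = ∀ x → S x → x ≤₃ v

IsInf : (𝟛 → Set) → 𝟛 → Set
IsInf S v = IsLowerBound S v × (∀ w → IsLowerBound S w → w ≤₃ v)

IsSup : (𝟛 → Set) → 𝟛 → Set
IsSup S v = IsUpperBound S v × (∀ w → IsUpperBound S w → v ≤₃ w)

record Semitopology (P : Set) : Set₁ where
  field
    Open : (P → Set) → Set
    open-full : Open (λ _ → ⊤)
    open-⋃ : (I : Set) (U : I → P → Set) → (∀ i → Open (U i)) →
             Open (λ p → Σ I (λ i → U i p))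

module _ {P : Set} (T : Semitopology P) where
  open Semitopology T

  NonemptyOpen : (P → Set) → Set
  NonemptyOpen O = Open O × Σ P O

  ThreeTwined : Set₁
  ThreeTwined = ∀ O₁ O₂ O₃ → NonemptyOpen O₁ → NonemptyOpen O₂ → NonemptyOpen O₃ →
                Σ P (λ p → O₁ p × O₂ p × O₃ p)

  Image : (P → 𝟛) → (P → Set) → 𝟛 → Set
  Image f O x = Σ P (λ p → O p × f p ≡ x)

  -- Quorum f = ⋁_{O ∈ O^{≠∅}} ⋀_{p ∈ O} f p   (q is that value)
  IsQuorum : (P → 𝟛) → 𝟛 → Set₁
  IsQuorum f q = IsSup' q
    where
      S : 𝟛 → Set₁
      S x = Σ (P → Set) (λ O → NonemptyOpen O × IsInf (Image f O) x)
      IsSup' : 𝟛 → Set₁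
      IsSup' v = (∀ x → S x → x ≤₃ v) × (∀ w → (∀ x → S x → x ≤₃ w) → v ≤₃ w)

  -- Contraquorum f = ⋀_{O ∈ O^{≠∅}} ⋁_{p ∈ O} f p
  IsContraquorum : (P → 𝟛) → 𝟛 → Set₁
  IsContraquorum f c = IsInf' c
    where
      S : 𝟛 → Set₁
      S x = Σ (P → Set) (λ O → NonemptyOpen O × IsSup (Image f O) x)
      IsInf' : 𝟛 → Set₁
      IsInf' v = (∀ x → S x → v ≤₃ x) × (∀ w → (∀ x → S x → w ≤₃ x) → w ≤₃ v)

-- 𝟛 is a Heyting algebra, so meets distribute over arbitrary joins:
-- Quorum f ∧ Quorum f' is the join of the values (⋀_{O₁} f) ∧ (⋀_{O₂} f').
-- For any nonempty open O, 3-twinedness gives a point p ∈ O₁ ∩ O₂ ∩ O, whence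
-- (⋀_{O₁} f) ∧ (⋀_{O₂} f') ≤ f p ∧ f' p ≤ ⋁_O (f ∧ f').  Taking the join over
-- O₁, O₂ and the meet over O yields the inequality; validity is upward closed.
module Submission where

open import Defs
open import Data.Product using (_×_; _,_; proj₁; proj₂)
open import Relation.Binary.Lattice.Definitions using (Exponential)
open import Relation.Binary.PropositionalEquality using (_≡_; refl; subst)

≤₃-trans : ∀ {a b c} → a ≤₃ b → b ≤₃ c → a ≤₃ c
≤₃-trans f≤  _   = f≤
≤₃-trans b≤b b≤c = b≤c
≤₃-trans b≤t t≤t = b≤t
≤₃-trans t≤t t≤t = t≤t

∧₃-comm : ∀ a b → a ∧₃ b ≡ b ∧₃ a
∧₃-comm 𝐟 𝐟 = refl
∧₃-comm 𝐟 𝐛 = refl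
∧₃-comm 𝐟 𝐭 = refl
∧₃-comm 𝐛 𝐟 = refl
∧₃-comm 𝐛 𝐛 = refl
∧₃-comm 𝐛 𝐭 = refl
∧₃-comm 𝐭 𝐟 = refl
∧₃-comm 𝐭 𝐛 = refl
∧₃-comm 𝐭 𝐭 = refl

∧₃-mono : ∀ {a b a' b'} → a ≤₃ b → a' ≤₃ b' → (a ∧₃ a') ≤₃ (b ∧₃ b')
∧₃-mono f≤  _   = f≤
∧₃-mono b≤b f≤  = f≤
∧₃-mono b≤b b≤b = b≤b
∧₃-mono b≤b b≤t = b≤b
∧₃-mono b≤b t≤t = b≤b
∧₃-mono b≤t f≤  = f≤
∧₃-mono b≤t b≤b = b≤b
∧₃-mono b≤t b≤t = b≤t
∧₃-mono b≤t t≤t = b≤t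
∧₃-mono t≤t a'≤b' = a'≤b'

Valid-mono : ∀ {a b} → a ≤₃ b → Valid a → Valid b
Valid-mono b≤b valid-b = valid-b
Valid-mono b≤t valid-b = valid-t
Valid-mono t≤t valid-t = valid-t

_⇨₃_ : 𝟛 → 𝟛 → 𝟛
𝐟 ⇨₃ c = 𝐭
𝐛 ⇨₃ 𝐟 = 𝐟
𝐛 ⇨₃ _ = 𝐭
𝐭 ⇨₃ c = c

⇨₃-exponential : Exponential _≤₃_ _∧₃_ _⇨₃_
⇨₃-exponential w x y = curry w x y , uncurry w x y
  where
  curry : ∀ w x y → (w ∧₃ x) ≤₃ y → w ≤₃ (x ⇨₃ y)
  curry 𝐟 _ _   _ = f≤
  curry 𝐛 𝐟 _   _ = b≤t
  curry 𝐛 𝐛 𝐛   _ = b≤t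
  curry 𝐛 𝐛 𝐭   _ = b≤t
  curry 𝐛 𝐭 𝐛   _ = b≤b
  curry 𝐛 𝐭 𝐭   _ = b≤t
  curry 𝐭 𝐟 _   _ = t≤t
  curry 𝐭 𝐛 𝐛   _ = t≤t
  curry 𝐭 𝐛 𝐭   _ = t≤t
  curry 𝐭 𝐭 𝐭   _ = t≤t

  uncurry : ∀ w x y → w ≤₃ (x ⇨₃ y) → (w ∧₃ x) ≤₃ y
  uncurry 𝐟 _ _   _   = f≤
  uncurry 𝐛 𝐟 _   _   = f≤
  uncurry 𝐛 𝐛 𝐛   _   = b≤b
  uncurry 𝐛 𝐛 𝐭   _   = b≤t
  uncurry 𝐛 𝐭 𝐛   _   = b≤b
  uncurry 𝐛 𝐭 𝐭   _   = b≤t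
  uncurry 𝐭 𝐟 _   _   = f≤
  uncurry 𝐭 𝐛 𝐛   _   = b≤b
  uncurry 𝐭 𝐛 𝐭   _   = b≤t
  uncurry 𝐭 𝐭 𝐭   _   = t≤t

IsJoin : ∀ {ℓ} → (𝟛 → Set ℓ) → 𝟛 → Set ℓ
IsJoin S v = (∀ x → S x → x ≤₃ v) × (∀ w → (∀ x → S x → x ≤₃ w) → v ≤₃ w)

∧₃-join-≤ : ∀ {ℓ ℓ'} {S : 𝟛 → Set ℓ} {S' : 𝟛 → Set ℓ'} {q q' y : 𝟛} →
            IsJoin S q → IsJoin S' q' →
            (∀ x x' → S x → S' x' → (x ∧₃ x') ≤₃ y) → (q ∧₃ q') ≤₃ y
∧₃-join-≤ {q = q} {q'} {y} (_ , least) (_ , least') below =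
  swap q' q (uncurry q' q (least' (q ⇨₃ y) λ x' x'∈S' →
    curry x' q (swap q x' (uncurry q x' (least (x' ⇨₃ y) λ x x∈S →
      curry x x' (below x x' x∈S x'∈S'))))))
  where
  curry : ∀ w x → (w ∧₃ x) ≤₃ y → w ≤₃ (x ⇨₃ y)
  curry w x = proj₁ (⇨₃-exponential w x y)
  uncurry : ∀ w x → w ≤₃ (x ⇨₃ y) → (w ∧₃ x) ≤₃ y
  uncurry w x = proj₂ (⇨₃-exponential w x y)
  swap : ∀ a b → (a ∧₃ b) ≤₃ y → (b ∧₃ a) ≤₃ y
  swap a b = subst (_≤₃ y) (∧₃-comm a b)

module _ {P : Set} (T : Semitopology P) (twined : ThreeTwined T) where

  inf-∧-inf-≤-sup : ∀ {f f' O₁ O₂ O y y' s} →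
    NonemptyOpen T O₁ → NonemptyOpen T O₂ → NonemptyOpen T O →
    IsInf (Image T f O₁) y → IsInf (Image T f' O₂) y' →
    IsSup (Image T (f ∧ᶠ f') O) s → (y ∧₃ y') ≤₃ s
  inf-∧-inf-≤-sup {f} {f'} {O₁} {O₂} {O} ne₁ ne₂ ne (y≤ , _) (y'≤ , _) (≤s , _)
    with twined O₁ O₂ O ne₁ ne₂ ne
  ... | p , p∈O₁ , p∈O₂ , p∈O =
    ≤₃-trans (∧₃-mono (y≤ (f p) (p , p∈O₁ , refl)) (y'≤ (f' p) (p , p∈O₂ , refl)))
             (≤s (f p ∧₃ f' p) (p , p∈O , refl))

theorem2p14 : {P : Set} (T : Semitopology P) → ThreeTwined T →
    (f f' : P → 𝟛) (q q' c : 𝟛) →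
    IsQuorum T f q → IsQuorum T f' q' → IsContraquorum T (f ∧ᶠ f') c →
    ((q ∧₃ q') ≤₃ c) × (Valid (q ∧₃ q') → Valid c)
theorem2p14 T twined f f' q q' c quorum quorum' (_ , greatest) =
  qq'≤c , Valid-mono qq'≤c
  where
  qq'≤c : (q ∧₃ q') ≤₃ c
  qq'≤c = greatest (q ∧₃ q') λ s (O , ne , sup) →
    ∧₃-join-≤ quorum quorum' λ y y' (O₁ , ne₁ , inf) (O₂ , ne₂ , inf') →
      inf-∧-inf-≤-sup T twined ne₁ ne₂ ne inf inf' sup
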